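{- The class of $\mathsf{GL}_2$-chains does not have the amalgamation property.
   Context: An $\mathsf{FL}_{ew}$-algebra is a commutative integral residuated lattice with an extra constant $0$ as bottom. $\mathsf{GL}_2$ is the variety of $\mathsf{FL}_{ew}$-algebras generated by the totally ordered $\mathsf{FL}_{ew}$-algebras satisfying $x^2=x^3$ and, for all $x,y$, $x=1$ or $x(x\wedge y)\le(x\wedge y)^2$; $\mathsf{GL}_2$-chains are its totally ordered members. A class has the amalgamation property if for all $\mathbf A,\mathbf B,\mathbf C$ in it and embeddings $i:\mathbf A\to\mathbf B$, $j:\mathbf A\to\mathbf C$ there exist $\mathbf D$ in the class and embeddings $h:\mathbf B\to\mathbf D$, $k:\mathbf C\to\mathbf D$ with $h\circ i=k\circ j$. -}

module Defs where

open import Data.Nat using (ℕ)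
open import Data.Product using (Σ; _×_; _,_)
open import Data.Sum using (_⊎_)
open import Relation.Binary.PropositionalEquality using (_≡_)
open import Relation.Nullary using (¬_)
open import Level using (Level)

record FLew : Set₁ where
  field
    Carrier : Set
    _∧_ _∨_ _·_ _⇒_ : Carrier → Carrier → Carrier
    one zero : Carrier

  infixr 6 _∧_ _∨_
  infixr 7 _·_
  infixr 5 _⇒_

  _≤_ : Carrier → Carrier → Set
  x ≤ y = x ∧ y ≡ x

  field
    ∧-comm   : ∀ x y → x ∧ y ≡ y ∧ x
    ∧-assoc  : ∀ x y z → (x ∧ y) ∧ z ≡ x ∧ (y ∧ z)
    ∨-comm   : ∀ x y → x ∨ y ≡ y ∨ x
    ∨-assoc  : ∀ x y z → (x ∨ y) ∨ z ≡ x ∨ (y ∨ z)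
    ∧-absorbs-∨ : ∀ x y → x ∧ (x ∨ y) ≡ x
    ∨-absorbs-∧ : ∀ x y → x ∨ (x ∧ y) ≡ x
    ·-comm   : ∀ x y → x · y ≡ y · x
    ·-assoc  : ∀ x y z → (x · y) · z ≡ x · (y · z)
    ·-identityˡ : ∀ x → one · x ≡ x
    residuated : ∀ x y z → ((x · y) ≤ z → y ≤ (x ⇒ z)) × (y ≤ (x ⇒ z) → (x · y) ≤ z)
    integral : ∀ x → x ≤ one
    zero-bot : ∀ x → zero ≤ x

open FLew public using (Carrier)

IsChain : FLew → Set
IsChain A = ∀ x y → (x ≤ y) ⊎ (y ≤ x)
  where open FLew A

InK : FLew → Set
InK A = IsChain A
      × (∀ x → x · x ≡ x · (x · x))
      × (∀ x y → (x ≡ one) ⊎ ((x · (x ∧ y)) ≤ ((x ∧ y) · (x ∧ y))))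
  where open FLew A

data Term : Set where
  var  : ℕ → Term
  meet join mul imp : Term → Term → Term
  tone tzero : Term

eval : (A : FLew) → (ℕ → Carrier A) → Term → Carrier A
eval A ρ (var n) = ρ n
eval A ρ (meet s t) = FLew._∧_ A (eval A ρ s) (eval A ρ t)
eval A ρ (join s t) = FLew._∨_ A (eval A ρ s) (eval A ρ t)
eval A ρ (mul s t) = FLew._·_ A (eval A ρ s) (eval A ρ t)
eval A ρ (imp s t) = FLew._⇒_ A (eval A ρ s) (eval A ρ t)
eval A ρ tone = FLew.one A
eval A ρ tzero = FLew.zero A

_⊨_≈_ : FLew → Term → Term → Set
A ⊨ s ≈ t = ∀ (ρ : ℕ → Carrier A) → eval A ρ s ≡ eval A ρ t

-- Membership in GL₂ = the variety generated by K (via Birkhoff's HSP theorem: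
-- A satisfies every equation valid in all members of K).
InGL2 : FLew → Set₁
InGL2 A = ∀ s t → (∀ B → InK B → B ⊨ s ≈ t) → A ⊨ s ≈ t

GL2Chain : FLew → Set₁
GL2Chain A = InGL2 A × IsChain A

record Embedding (A B : FLew) : Set where
  module A = FLew A
  module B = FLew B
  field
    f : Carrier A → Carrier B
    injective : ∀ x y → f x ≡ f y → x ≡ y
    pres-∧ : ∀ x y → f (x A.∧ y) ≡ f x B.∧ f y
    pres-∨ : ∀ x y → f (x A.∨ y) ≡ f x B.∨ f y
    pres-· : ∀ x y → f (x A.· y) ≡ f x B.· f y
    pres-⇒ : ∀ x y → f (x A.⇒ y) ≡ f x B.⇒ f y
    pres-1 : f A.one ≡ B.one
    pres-0 : f A.zero ≡ B.zero

open Embedding public using (f)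

HasAP : (FLew → Set₁) → Set₁
HasAP P = ∀ (A B C : FLew) → P A → P B → P C →
          (i : Embedding A B) (j : Embedding A C) →
          Σ FLew λ D → P D × Σ (Embedding B D) λ h → Σ (Embedding C D) λ k →
            ∀ a → f h (f i a) ≡ f k (f j a)

-- The three-element MV-chain Ł₃ has an element b ≠ 0 with b² = 0, and the three-element Gödel
-- chain G₃ an element c ≠ 1 with ¬c = 0; both are GL₂-chains containing the two-element Boolean
-- algebra. No GL₂-chain contains such b and c together: if b ≤ c, the identity
-- x ∨ (x(x ∧ y) ⇒ (x ∧ y)²) ≈ 1 of the generating class gives cb ≤ b² = 0, and if c ≤ b,
-- monotonicity gives cb ≤ b² = 0; either way b ≤ ¬c = 0. So Ł₃ and G₃ have no common extension
-- in the class, whether or not the embeddings agree on the Boolean algebra.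
module Submission where

open import Algebra.Core using (Op₂)
open import Data.Bool using (if_then_else_)
open import Data.Empty using (⊥; ⊥-elim)
open import Data.Fin using (Fin; fromℕ; toℕ)
open import Data.Fin.Patterns using (0F; 1F; 2F)
open import Data.Fin.Properties using (_≟_; all?)
open import Data.Nat using (ℕ; suc; _≤ᵇ_)
open import Data.Product using (_×_; _,_; proj₁; proj₂)
open import Data.Sum using (_⊎_; inj₁; inj₂)
open import Relation.Binary.PropositionalEquality
  using (_≡_; _≢_; refl; sym; trans; cong; subst; module ≡-Reasoning)
open import Relation.Nullary using (¬_; Dec)
open import Relation.Nullary.Decidable using (from-yes; _×-dec_; _⊎-dec_; _→-dec_)

open import Defs

KCondition : FLew → Set
KCondition A = ∀ x y → (x ≡ one) ⊎ ((x · (x ∧ y)) ≤ ((x ∧ y) · (x ∧ y)))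
  where open FLew A

module FLewProperties (A : FLew) where
  open FLew A

  ≤-trans : ∀ {x y z} → x ≤ y → y ≤ z → x ≤ z
  ≤-trans {x} {y} {z} x≤y y≤z = begin
    x ∧ z        ≡⟨ cong (_∧ z) (sym x≤y) ⟩
    (x ∧ y) ∧ z  ≡⟨ ∧-assoc x y z ⟩
    x ∧ (y ∧ z)  ≡⟨ cong (x ∧_) y≤z ⟩
    x ∧ y        ≡⟨ x≤y ⟩
    x            ∎
    where open ≡-Reasoning

  ≤-refl : ∀ x → x ≤ x
  ≤-refl x = begin
    x ∧ x              ≡⟨ cong (x ∧_) (sym (∨-absorbs-∧ x x)) ⟩
    x ∧ (x ∨ (x ∧ x))  ≡⟨ ∧-absorbs-∨ x (x ∧ x) ⟩
    x                  ∎
    where open ≡-Reasoning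

  x≤zero⇒x≡zero : ∀ {x} → x ≤ zero → x ≡ zero
  x≤zero⇒x≡zero {x} x≤0 = trans (sym x≤0) (trans (∧-comm x zero) (zero-bot x))

  ∨-absorbsʳ-≤ : ∀ {x y} → x ≤ y → x ∨ y ≡ y
  ∨-absorbsʳ-≤ {x} {y} x≤y = begin
    x ∨ y        ≡⟨ ∨-comm x y ⟩
    y ∨ x        ≡⟨ cong (y ∨_) (sym (trans (∧-comm y x) x≤y)) ⟩
    y ∨ (y ∧ x)  ≡⟨ ∨-absorbs-∧ y x ⟩
    y            ∎
    where open ≡-Reasoning

  ∨-zeroʳ : ∀ x → x ∨ one ≡ one
  ∨-zeroʳ x = ∨-absorbsʳ-≤ (integral x)

  ∨-zeroˡ : ∀ x → one ∨ x ≡ one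
  ∨-zeroˡ x = trans (∨-comm one x) (∨-zeroʳ x)

  ·-identityʳ : ∀ x → x · one ≡ x
  ·-identityʳ x = trans (·-comm x one) (·-identityˡ x)

  curry-≤ : ∀ {x y z} → (x · y) ≤ z → y ≤ (x ⇒ z)
  curry-≤ {x} {y} {z} = proj₁ (residuated x y z)

  uncurry-≤ : ∀ {x y z} → y ≤ (x ⇒ z) → (x · y) ≤ z
  uncurry-≤ {x} {y} {z} = proj₂ (residuated x y z)

  ⇒≡one⇒≤ : ∀ {x y} → (x ⇒ y) ≡ one → x ≤ y
  ⇒≡one⇒≤ {x} {y} x⇒y≡1 =
    subst (_≤ y) (·-identityʳ x) (uncurry-≤ (trans (cong (one ∧_) x⇒y≡1) (integral one)))

  ≤⇒⇒≡one : ∀ {x y} → x ≤ y → (x ⇒ y) ≡ one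
  ≤⇒⇒≡one {x} {y} x≤y = begin
    x ⇒ y          ≡⟨ sym (integral (x ⇒ y)) ⟩
    (x ⇒ y) ∧ one  ≡⟨ ∧-comm (x ⇒ y) one ⟩
    one ∧ (x ⇒ y)  ≡⟨ curry-≤ (subst (_≤ y) (sym (·-identityʳ x)) x≤y) ⟩
    one            ∎
    where open ≡-Reasoning

  ·-monoʳ-≤ : ∀ z {x y} → x ≤ y → (z · x) ≤ (z · y)
  ·-monoʳ-≤ z x≤y = uncurry-≤ (≤-trans x≤y (curry-≤ (≤-refl _)))

  module _ (chain : IsChain A) where

    ∨≡one⇒≡one : ∀ {x y} → (x ∨ y) ≡ one → (x ≡ one) ⊎ (y ≡ one)
    ∨≡one⇒≡one {x} {y} x∨y≡1 with chain x y
    ... | inj₁ x≤y = inj₂ (trans (sym (∨-absorbsʳ-≤ x≤y)) x∨y≡1)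
    ... | inj₂ y≤x = inj₁ (trans (sym (trans (∨-comm x y) (∨-absorbsʳ-≤ y≤x))) x∨y≡1)

-- x ∨ (x(x ∧ y) ⇒ (x ∧ y)²) ≈ 1: on chains, a join is 1 iff one of its arguments is, so this
-- identity is equivalent to the defining disjunction of K.
K-term : Term
K-term = join x (imp (mul x (meet x y)) (mul (meet x y) (meet x y)))
  where
    x y : Term
    x = var 0
    y = var 1

module _ (A : FLew) where
  open FLew A
  open FLewProperties A

  K⊨K-term≈one : InK A → A ⊨ K-term ≈ tone
  K⊨K-term≈one (_ , _ , kc) ρ with kc (ρ 0) (ρ 1)
  ... | inj₁ x≡1 rewrite x≡1 = ∨-zeroˡ _
  ... | inj₂ kx≤ = trans (cong (ρ 0 ∨_) (≤⇒⇒≡one kx≤)) (∨-zeroʳ (ρ 0))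

module _ (A : FLew) where
  open FLewProperties A

  K⇒GL2Chain : InK A → GL2Chain A
  K⇒GL2Chain inK = (λ s t valid → valid A inK) , proj₁ inK

  GL2Chain⇒KCondition : GL2Chain A → KCondition A
  GL2Chain⇒KCondition (gl2 , chain) x y
    with ∨≡one⇒≡one chain (gl2 K-term tone K⊨K-term≈one (λ { 0 → x ; _ → y }))
  ... | inj₁ x≡1 = inj₁ x≡1
  ... | inj₂ ⇒≡1 = inj₂ (⇒≡one⇒≤ ⇒≡1)

module _ (D : FLew) (chain : IsChain D) (kc : KCondition D) where
  open FLew D
  open FLewProperties D

  nilpotent≡zero : ∀ {b c} → (c ⇒ zero) ≡ zero → c ≢ one → (b · b) ≡ zero → b ≡ zero
  nilpotent≡zero {b} {c} ¬c≡0 c≢1 b²≡0 =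
    x≤zero⇒x≡zero (subst (b ≤_) ¬c≡0 (curry-≤ (subst ((c · b) ≤_) b²≡0 cb≤b²)))
    where
      cb≤b² : (c · b) ≤ (b · b)
      cb≤b² with chain b c
      ... | inj₂ c≤b = subst (_≤ (b · b)) (·-comm b c) (·-monoʳ-≤ b c≤b)
      ... | inj₁ b≤c with kc c b
      ...   | inj₁ c≡1 = ⊥-elim (c≢1 c≡1)
      ...   | inj₂ kcb = subst (λ w → (c · w) ≤ (w · w)) (trans (∧-comm c b) b≤c) kcb

module FiniteChain (n : ℕ) where
  infixr 6 _∧_ _∨_
  infix 4 _≤_ _≤?_

  Elt : Set
  Elt = Fin (suc n)

  _∧_ _∨_ : Op₂ Elt
  x ∧ y = if toℕ x ≤ᵇ toℕ y then x else y
  x ∨ y = if toℕ x ≤ᵇ toℕ y then y else x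

  top : Elt
  top = fromℕ n

  _≤_ : Elt → Elt → Set
  x ≤ y = x ∧ y ≡ x

  _≤?_ : ∀ x y → Dec (x ≤ y)
  x ≤? y = x ∧ y ≟ x

  module Residuated (_·_ _⇒_ : Op₂ Elt) where

    Laws : Set
    Laws = (∀ x y → x ∧ y ≡ y ∧ x)
         × (∀ x y z → (x ∧ y) ∧ z ≡ x ∧ (y ∧ z))
         × (∀ x y → x ∨ y ≡ y ∨ x)
         × (∀ x y z → (x ∨ y) ∨ z ≡ x ∨ (y ∨ z))
         × (∀ x y → x ∧ (x ∨ y) ≡ x)
         × (∀ x y → x ∨ (x ∧ y) ≡ x)
         × (∀ x y → (x · y) ≡ (y · x))
         × (∀ x y z → ((x · y) · z) ≡ (x · (y · z)))
         × (∀ x → (top · x) ≡ x)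
         × (∀ x y z → ((x · y) ≤ z → y ≤ (x ⇒ z)) × (y ≤ (x ⇒ z) → (x · y) ≤ z))
         × (∀ x → x ≤ top)
         × (∀ x → 0F ≤ x)

    laws? : Dec Laws
    laws? = (all? λ x → all? λ y → x ∧ y ≟ y ∧ x)
      ×-dec (all? λ x → all? λ y → all? λ z → (x ∧ y) ∧ z ≟ x ∧ (y ∧ z))
      ×-dec (all? λ x → all? λ y → x ∨ y ≟ y ∨ x)
      ×-dec (all? λ x → all? λ y → all? λ z → (x ∨ y) ∨ z ≟ x ∨ (y ∨ z))
      ×-dec (all? λ x → all? λ y → x ∧ (x ∨ y) ≟ x)
      ×-dec (all? λ x → all? λ y → x ∨ (x ∧ y) ≟ x)
      ×-dec (all? λ x → all? λ y → (x · y) ≟ (y · x))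
      ×-dec (all? λ x → all? λ y → all? λ z → ((x · y) · z) ≟ (x · (y · z)))
      ×-dec (all? λ x → (top · x) ≟ x)
      ×-dec (all? λ x → all? λ y → all? λ z →
               ((x · y) ≤? z →-dec y ≤? (x ⇒ z)) ×-dec (y ≤? (x ⇒ z) →-dec (x · y) ≤? z))
      ×-dec (all? λ x → x ≤? top)
      ×-dec (all? λ x → 0F ≤? x)

    algebra : Laws → FLew
    algebra (∧c , ∧a , ∨c , ∨a , ∧∨ , ∨∧ , ·c , ·a , ·id , res , int , bot) = record
      { Carrier = Elt ; _∧_ = _∧_ ; _∨_ = _∨_ ; _·_ = _·_ ; _⇒_ = _⇒_ ; one = top ; zero = 0F
      ; ∧-comm = ∧c ; ∧-assoc = ∧a ; ∨-comm = ∨c ; ∨-assoc = ∨a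
      ; ∧-absorbs-∨ = ∧∨ ; ∨-absorbs-∧ = ∨∧
      ; ·-comm = ·c ; ·-assoc = ·a ; ·-identityˡ = ·id
      ; residuated = res ; integral = int ; zero-bot = bot }

    inK? : (l : Laws) → Dec (InK (algebra l))
    inK? l = (all? λ x → all? λ y → x ≤? y ⊎-dec y ≤? x)
      ×-dec (all? λ x → (x · x) ≟ (x · (x · x)))
      ×-dec (all? λ x → all? λ y → x ≟ top ⊎-dec (x · (x ∧ y)) ≤? ((x ∧ y) · (x ∧ y)))

  _⇒ᴳ_ : Op₂ Elt
  x ⇒ᴳ y = if toℕ x ≤ᵇ toℕ y then top else y

  module Gödel = Residuated _∧_ _⇒ᴳ_

module _ {m n : ℕ} {·₁ ⇒₁ : Op₂ (Fin (suc m))} {·₂ ⇒₂ : Op₂ (Fin (suc n))}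
         (l₁ : FiniteChain.Residuated.Laws m ·₁ ⇒₁) (l₂ : FiniteChain.Residuated.Laws n ·₂ ⇒₂)
         (g : Fin (suc m) → Fin (suc n)) where
  private
    module A = FLew (FiniteChain.Residuated.algebra m ·₁ ⇒₁ l₁)
    module B = FLew (FiniteChain.Residuated.algebra n ·₂ ⇒₂ l₂)

  IsEmbedding : Set
  IsEmbedding = (∀ x y → g x ≡ g y → x ≡ y)
              × (∀ x y → g (x A.∧ y) ≡ g x B.∧ g y)
              × (∀ x y → g (x A.∨ y) ≡ g x B.∨ g y)
              × (∀ x y → g (x A.· y) ≡ g x B.· g y)
              × (∀ x y → g (x A.⇒ y) ≡ g x B.⇒ g y)
              × (g A.one ≡ B.one)
              × (g A.zero ≡ B.zero)

  isEmbedding? : Dec IsEmbedding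
  isEmbedding? = (all? λ x → all? λ y → g x ≟ g y →-dec x ≟ y)
    ×-dec (all? λ x → all? λ y → g (x A.∧ y) ≟ g x B.∧ g y)
    ×-dec (all? λ x → all? λ y → g (x A.∨ y) ≟ g x B.∨ g y)
    ×-dec (all? λ x → all? λ y → g (x A.· y) ≟ g x B.· g y)
    ×-dec (all? λ x → all? λ y → g (x A.⇒ y) ≟ g x B.⇒ g y)
    ×-dec g A.one ≟ B.one
    ×-dec g A.zero ≟ B.zero

  embedding : IsEmbedding → Embedding (FiniteChain.Residuated.algebra m ·₁ ⇒₁ l₁)
                                      (FiniteChain.Residuated.algebra n ·₂ ⇒₂ l₂)
  embedding (inj , g-∧ , g-∨ , g-· , g-⇒ , g-one , g-zero) = record
    { f = g ; injective = inj ; pres-∧ = g-∧ ; pres-∨ = g-∨ ; pres-· = g-· ; pres-⇒ = g-⇒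
    ; pres-1 = g-one ; pres-0 = g-zero }

module _ {A B : FLew} (e : Embedding A B) where
  private
    module A = FLew A
    module B = FLew B
  open Embedding e using (injective; pres-·; pres-⇒; pres-1; pres-0)

  ≢zero⇒f≢zero : ∀ {x} → x ≢ A.zero → f e x ≢ B.zero
  ≢zero⇒f≢zero x≢0 fx≡0 = x≢0 (injective _ _ (trans fx≡0 (sym pres-0)))

  ≢one⇒f≢one : ∀ {x} → x ≢ A.one → f e x ≢ B.one
  ≢one⇒f≢one x≢1 fx≡1 = x≢1 (injective _ _ (trans fx≡1 (sym pres-1)))

  nilpotent⇒f-nilpotent : ∀ {x} → x A.· x ≡ A.zero → f e x B.· f e x ≡ B.zero
  nilpotent⇒f-nilpotent {x} x²≡0 = trans (sym (pres-· x x)) (trans (cong (f e) x²≡0) pres-0)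

  dense⇒f-dense : ∀ {x} → (x A.⇒ A.zero) ≡ A.zero → (f e x B.⇒ B.zero) ≡ B.zero
  dense⇒f-dense {x} ¬x≡0 = begin
    f e x B.⇒ B.zero      ≡⟨ cong (f e x B.⇒_) (sym pres-0) ⟩
    f e x B.⇒ f e A.zero  ≡⟨ sym (pres-⇒ x A.zero) ⟩
    f e (x A.⇒ A.zero)    ≡⟨ cong (f e) ¬x≡0 ⟩
    f e A.zero            ≡⟨ pres-0 ⟩
    B.zero                ∎
    where open ≡-Reasoning

module Chain₂ = FiniteChain 1
module Chain₃ = FiniteChain 2

𝟐-laws : Chain₂.Gödel.Laws
𝟐-laws = from-yes Chain₂.Gödel.laws?

𝟐 : FLew
𝟐 = Chain₂.Gödel.algebra 𝟐-laws

𝟐-GL2 : GL2Chain 𝟐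
𝟐-GL2 = K⇒GL2Chain _ (from-yes (Chain₂.Gödel.inK? 𝟐-laws))

G₃-laws : Chain₃.Gödel.Laws
G₃-laws = from-yes Chain₃.Gödel.laws?

G₃ : FLew
G₃ = Chain₃.Gödel.algebra G₃-laws

G₃-GL2 : GL2Chain G₃
G₃-GL2 = K⇒GL2Chain _ (from-yes (Chain₃.Gödel.inK? G₃-laws))

_·ᴸ_ _⇒ᴸ_ : Op₂ (Fin 3)
2F ·ᴸ y  = y
x  ·ᴸ 2F = x
_  ·ᴸ _  = 0F

2F ⇒ᴸ y  = y
1F ⇒ᴸ 0F = 1F
_  ⇒ᴸ _  = 2F

module Łukasiewicz₃ = Chain₃.Residuated _·ᴸ_ _⇒ᴸ_

Ł₃-laws : Łukasiewicz₃.Laws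
Ł₃-laws = from-yes Łukasiewicz₃.laws?

Ł₃ : FLew
Ł₃ = Łukasiewicz₃.algebra Ł₃-laws

Ł₃-GL2 : GL2Chain Ł₃
Ł₃-GL2 = K⇒GL2Chain _ (from-yes (Łukasiewicz₃.inK? Ł₃-laws))

ι : Fin 2 → Fin 3
ι 0F = 0F
ι 1F = 2F

ι-Ł₃ : Embedding 𝟐 Ł₃
ι-Ł₃ = embedding 𝟐-laws Ł₃-laws ι (from-yes (isEmbedding? 𝟐-laws Ł₃-laws ι))

ι-G₃ : Embedding 𝟐 G₃
ι-G₃ = embedding 𝟐-laws G₃-laws ι (from-yes (isEmbedding? 𝟐-laws G₃-laws ι))

-- The middle element 1F plays the role of b in Ł₃ and of c in G₃.
no-GL2Chain-extends-Ł₃-and-G₃ : ∀ D → GL2Chain D → Embedding Ł₃ D → Embedding G₃ D → ⊥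
no-GL2Chain-extends-Ł₃-and-G₃ D (D-GL2 , D-chain) h k = ≢zero⇒f≢zero h {1F} (λ ()) h1F≡0
  where
    h1F≡0 : f h 1F ≡ FLew.zero D
    h1F≡0 = nilpotent≡zero D D-chain (GL2Chain⇒KCondition D (D-GL2 , D-chain))
             (dense⇒f-dense k {1F} refl) (≢one⇒f≢one k {1F} (λ ()))
             (nilpotent⇒f-nilpotent h {1F} refl)

theorem6p11 : ¬ HasAP GL2Chain
theorem6p11 ap =
  let D , D-GL2 , h , k , _ = ap 𝟐 Ł₃ G₃ 𝟐-GL2 Ł₃-GL2 G₃-GL2 ι-Ł₃ ι-G₃
  in  no-GL2Chain-extends-Ł₃-and-G₃ D D-GL2 h k
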